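{- Let $\Delta$ be a product of an even number of distinct primes, let $N$ be a positive integer coprime to $\Delta$, and let $p$ be a prime such that: $p\equiv 1 \pmod 4$; $p\equiv 5\pmod 8$ if $2\mid\Delta$; $p\equiv 1\pmod 8$ if $2\mid N$; $\left(\frac{p}{p_i}\right)=-1$ for every odd prime $p_i\mid\Delta$; and $\left(\frac{p}{\ell}\right)=1$ for every odd prime $\ell\mid N$. Let $B(N,p)$ be the quaternion algebra over $\mathbf{Q}$ with basis $1,i,j,k$, where $i^2=-\Delta N$, $j^2=p$, $k=ij=-ji$. Fix $a\in\mathbf{Z}$ with $a^2\Delta N+1\equiv 0\pmod p$ and let $R(N)=\mathbf{Z}e_1+\mathbf{Z}e_2+\mathbf{Z}e_3+\mathbf{Z}e_4$ with $e_1=1$, $e_2=\frac{1+j}{2}$, $e_3=\frac{i+k}{2}$, $e_4=\frac{a\Delta N j+k}{p}$. Let $q$ be a prime with $q\nmid \Delta p$ and $\left(\frac{p}{q}\right)=-1$, and let $x,y\in\mathbf{Z}_q$ satisfy $-\Delta N=x^2-py^2$. Let $\varphi_q^N: B(N,p)\otimes_{\mathbf{Q}}\mathbf{Q}_q\to M_2(\mathbf{Q}_q)$ be the $\mathbf{Q}_q$-algebra isomorphism determined by $$\varphi_q^N(i)=\begin{pmatrix} x & -py\\ y & -x\end{pmatrix},\qquad \varphi_q^N(j)=\begin{pmatrix} 0 & p\\ 1 & 0\end{pmatrix}.$$ Define the sublattices of $R(N)$ $$L=\{h\in R(N): \varphi_q^N(h)\in \begin{pmatrix}\mathbf{Z}_q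 & \mathbf{Z}_q\\ qN\mathbf{Z}_q & \mathbf{Z}_q\end{pmatrix}\},\qquad L'=\{h\in R(N): \varphi_q^N(h)\in \begin{pmatrix}\mathbf{Z}_q & q\mathbf{Z}_q\\ N\mathbf{Z}_q & \mathbf{Z}_q\end{pmatrix}\}.$$ Let $c_1,c_2,c_3\in\mathbf{Z}$ satisfy $c_1\equiv y-x$, $c_2\equiv p^{ -1}$, $c_3\equiv x \pmod{q}$. Then $$f_1=e_1,\quad f_2=-c_1e_2+e_3,\quad f_3=-2c_2(a\Delta N-c_3)e_2+e_4,\quad f_4=qe_2$$ is a $\mathbf{Z}$-basis of $L$, and $$g_1=e_1,\quad g_2=c_1e_2+e_3,\quad g_3=-2c_2(a\Delta N+c_3)e_2+e_4,\quad g_4=qe_2$$ is a $\mathbf{Z}$-basis of $L'$.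
   Context: $B(N,p)$ is a representation of the indefinite quaternion algebra over $\mathbf{Q}$ of discriminant $\Delta$, and $R(N)$ is (Hashimoto's) Eichler order of level $N$ in it. In the paper the lattice $L$ is the Eichler order $R(Nq)$ viewed inside $R(N)$, and $L'$ is its conjugate $\delta_qR(Nq)\delta_q^{ -1}$, where $\delta_q\in B^\times$ comes by strong approximation from the idèle equal to $1$ away from $q$ and to $(\varphi_q^N)^{ -1}\begin{pmatrix} q&0\\0&1\end{pmatrix}$ at $q$. -}

module Defs where

open import Data.Nat as ℕ using (ℕ; suc; _^_)
open import Data.Nat.Primality using (Prime)
open import Data.Integer as ℤ using (ℤ; +_; _-_; _*_; _+_; -_)
open import Data.Integer.Divisibility as ℤD using ()
open import Data.Fin using (Fin; zero; suc)
open import Data.List using (List; length)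
open import Data.Nat.ListAction using (product)
open import Data.Nat.Divisibility using (_∣_)
open import Data.List.Relation.Unary.All using (All)
open import Data.List.Relation.Unary.Unique.Propositional using (Unique)
open import Data.Product using (Σ; ∃; _×_; _,_)
open import Relation.Binary.PropositionalEquality using (_≡_; _≢_)
open import Relation.Nullary using (¬_)

Cong : ℕ → ℤ → ℤ → Set
Cong m a b = (+ m) ℤD.∣ (a - b)

EvenDistinctPrimeProduct : ℕ → Set
EvenDistinctPrimeProduct Δ =
  Σ (List ℕ) λ ps → All Prime ps × Unique ps ×
    (∃ λ k → length ps ≡ 2 ℕ.* k) × Δ ≡ product ps

OddPrime : ℕ → Set
OddPrime ℓ = Prime ℓ × ℓ ≢ 2

SquareMod : ℕ → ℕ → Set
SquareMod ℓ p = ∃ λ (z : ℤ) → Cong ℓ (z * z) (+ p)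

LegendreIsOne : ℕ → ℕ → Set
LegendreIsOne p ℓ = OddPrime ℓ × ¬ (ℓ ∣ p) × SquareMod ℓ p

LegendreIsMinusOne : ℕ → ℕ → Set
LegendreIsMinusOne p ℓ = OddPrime ℓ × ¬ (ℓ ∣ p) × ¬ SquareMod ℓ p

-- q-adic integers ℤ_q as the inverse limit of ℤ/q^n:
-- coherent sequences of integer representatives, approx n taken mod q^n.
record ℤ[_] (q : ℕ) : Set where
  field
    approx   : ℕ → ℤ
    coherent : ∀ n → Cong (q ^ n) (approx (suc n)) (approx n)
open ℤ[_] public

-- A (not necessarily packaged) sequence s of representatives, read as the
-- q-adic number lim s n, lies in the ideal d ℤ_q:
-- there is w ∈ ℤ_q with s ≡ d·w (mod q^n) for all n.
InIdeal : (q d : ℕ) → (ℕ → ℤ) → Set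
InIdeal q d s = ∃ λ (w : ℤ[ q ]) → ∀ n → Cong (q ^ n) (s n) (+ d * approx w n)

-- Elements of R(N) = ℤe₁+ℤe₂+ℤe₃+ℤe₄ are given by their coordinates
-- v : Fin 4 → ℤ (v zero = coefficient of e₁, ..., v 3 = coefficient of e₄).
Coords : Set
Coords = Fin 4 → ℤ

module Setup (Δ N p : ℕ) (a : ℤ) (q : ℕ) (x y : ℤ[ q ]) where

  ΔN : ℤ
  ΔN = + (Δ ℕ.* N)

  P : ℤ
  P = + p

  -- 2p times the coordinates of h = Σ vₘ eₘ in the basis 1, i, j, k
  -- (e₁ = 1, e₂ = (1+j)/2, e₃ = (i+k)/2, e₄ = (aΔN j + k)/p):
  --   t₀ = v₁ + v₂/2,  t₁ = v₃/2,  t₂ = v₂/2 + aΔN v₄/p,  t₃ = v₃/2 + v₄/p.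
  T0 T1 T2 T3 : Coords → ℤ
  T0 v = + 2 * P * v zero + P * v (suc zero)
  T1 v = P * v (suc (suc zero))
  T2 v = P * v (suc zero) + + 2 * a * ΔN * v (suc (suc (suc zero)))
  T3 v = P * v (suc (suc zero)) + + 2 * v (suc (suc (suc zero)))

  -- Entries of 2p · φ_q^N(h) = 2p(t₀ 1 + t₁ X + t₂ J + t₃ XJ) with
  --   X = φ(i) = [[x, -p y], [y, -x]],  J = φ(j) = [[0, p], [1, 0]],
  --   XJ = φ(k) = [[-p y, p x], [-x, p y]],
  -- as sequences of representatives (x, y replaced by approx x n, approx y n).
  Φ11 Φ12 Φ21 Φ22 : Coords → ℕ → ℤ
  Φ11 v n = T0 v + T1 v * approx x n + T3 v * (- (P * approx y n))
  Φ12 v n = T1 v * (- (P * approx y n)) + T2 v * P + T3 v * (P * approx x n)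
  Φ21 v n = T1 v * approx y n + T2 v + T3 v * (- approx x n)
  Φ22 v n = T0 v + T1 v * (- approx x n) + T3 v * (P * approx y n)

  -- φ(h)ᵢⱼ ∈ d ℤ_q  ⇔  (2p φ(h))ᵢⱼ ∈ 2p d ℤ_q
  -- L  = { h ∈ R(N) : φ(h) ∈ [[ℤ_q, ℤ_q], [qNℤ_q, ℤ_q]] }
  InL : Coords → Set
  InL v = InIdeal q (2 ℕ.* p) (Φ11 v) × InIdeal q (2 ℕ.* p) (Φ12 v)
        × InIdeal q (2 ℕ.* p ℕ.* (q ℕ.* N)) (Φ21 v) × InIdeal q (2 ℕ.* p) (Φ22 v)

  InL' : Coords → Set
  InL' v = InIdeal q (2 ℕ.* p) (Φ11 v) × InIdeal q (2 ℕ.* p ℕ.* q) (Φ12 v)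
         × InIdeal q (2 ℕ.* p ℕ.* N) (Φ21 v) × InIdeal q (2 ℕ.* p) (Φ22 v)

lincomb : (Fin 4 → ℤ) → (Fin 4 → Coords) → Coords
lincomb c f k = c zero * f zero k + c (suc zero) * f (suc zero) k
              + c (suc (suc zero)) * f (suc (suc zero)) k
              + c (suc (suc (suc zero))) * f (suc (suc (suc zero))) k

IsZBasisOf : (Coords → Set) → (Fin 4 → Coords) → Set
IsZBasisOf S f =
  (∀ i → S (f i)) ×
  (∀ v → S v → ∃ λ c → ∀ k → lincomb c f k ≡ v k) ×
  (∀ c c' → (∀ k → lincomb c f k ≡ lincomb c' f k) → ∀ i → c i ≡ c' i)

⟨_,_,_,_⟩ : ℤ → ℤ → ℤ → ℤ → Coords
⟨ a₁ , a₂ , a₃ , a₄ ⟩ zero = a₁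
⟨ a₁ , a₂ , a₃ , a₄ ⟩ (suc zero) = a₂
⟨ a₁ , a₂ , a₃ , a₄ ⟩ (suc (suc zero)) = a₃
⟨ a₁ , a₂ , a₃ , a₄ ⟩ (suc (suc (suc zero))) = a₄

four : Coords → Coords → Coords → Coords → Fin 4 → Coords
four u v w z zero = u
four u v w z (suc zero) = v
four u v w z (suc (suc zero)) = w
four u v w z (suc (suc (suc zero))) = z

module Submission where

-- For h ∈ R(N) with coordinates v = (v₀,v₁,v₂,v₃) in e₁,…,e₄, the
-- entries of 2p·φ_q^N(h) are integer polynomials in the q-adic integers x, y; as q ∤ 2p
-- they always lie in 2p·ℤ_q.  Since q ∤ 2pN, membership in L (resp. L') imposes a
-- single condition, on the (2,1) (resp. (1,2)) entry, and a q-adic integer lies in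
-- u·q·ℤ_q for a unit u iff its class mod q vanishes.  Computing that class with
-- c₁ ≡ y − x, c₂ p ≡ 1, c₃ ≡ x (mod q) turns the condition into
--     q ∣ v₁ − α v₂ − β v₃
-- for the α, β of the claimed bases, and such a lattice has the basis
-- (1,0,0,0), (0,α,1,0), (0,β,0,1), (0,q,0,0).

open import Defs
open import Data.Empty using (⊥-elim)
open import Data.Fin using (Fin; zero; suc)
open import Data.Integer using (ℤ; +_; _-_; _*_; _+_; -_)
import Data.Integer.Coprimality as ℤCoprimality
open import Data.Integer.Divisibility.Signed as Signed using (divides; ∣ᵤ⇒∣; ∣⇒∣ᵤ)
import Data.Integer.Properties as ℤP
open import Data.Integer.Tactic.RingSolver using (solve-∀)
open import Data.Nat as ℕ using (ℕ; _<_; _%_; _^_)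
open import Data.Nat.Coprimality as Coprimality using (Coprime; coprime-Bézout)
open import Data.Nat.Divisibility using (_∣_; ∣1⇒≡1; ∣-trans)
open import Data.Nat.GCD using (module Bézout)
open import Data.Nat.Primality using (Prime; prime⇒irreducible; prime⇒nonZero; prime⇒nonTrivial; prime[2])
import Data.Nat.Tactic.RingSolver as ℕSolver
open import Data.Product using (_×_; _,_; ∃; proj₁; proj₂)
open import Data.Sum using (inj₁; inj₂)
open import Relation.Binary.PropositionalEquality
open import Relation.Nullary using (¬_)

pattern i₀ = zero
pattern i₁ = suc zero
pattern i₂ = suc (suc zero)
pattern i₃ = suc (suc (suc zero))

infix 4 _∣ℤ_
_∣ℤ_ : ℕ → ℤ → Set
m ∣ℤ z = + m Signed.∣ z

∣ℤ-zero : ∀ m → m ∣ℤ + 0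
∣ℤ-zero m = divides (+ 0) refl

∣ℤ-*ˡ : ∀ m q → q ∣ℤ + (m ℕ.* q)
∣ℤ-*ˡ m q = divides (+ m) (ℤP.pos-* m q)

coprime-*ʳ : ∀ {m n o} → Coprime m n → Coprime m o → Coprime m (n ℕ.* o)
coprime-*ʳ {m} {n} cmn cmo (d∣m , d∣no) =
  cmo (d∣m , Coprimality.coprime-divisor cdn d∣no)
  where
  cdn : Coprime _ n
  cdn (e∣d , e∣n) = cmn (∣-trans e∣d d∣m , e∣n)

coprime-*ˡ : ∀ {m n o} → Coprime m o → Coprime n o → Coprime (m ℕ.* n) o
coprime-*ˡ cmo cno = Coprimality.sym (coprime-*ʳ (Coprimality.sym cmo) (Coprimality.sym cno))

coprime-^ : ∀ {m n} → Coprime m n → ∀ k → Coprime m (n ^ k)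
coprime-^ c ℕ.zero    (_ , d∣1) = ∣1⇒≡1 d∣1
coprime-^ c (ℕ.suc k) = coprime-*ʳ c (coprime-^ c k)

prime⇒coprime : ∀ {q u} → Prime q → ¬ q ∣ u → Coprime u q
prime⇒coprime qp q∤u (d∣u , d∣q) with prime⇒irreducible qp d∣q
... | inj₁ d≡1 = d≡1
... | inj₂ refl = ⊥-elim (q∤u d∣u)

oddPrime∤2 : ∀ {q} → OddPrime q → ¬ q ∣ 2
oddPrime∤2 (qp , q≢2) q∣2 with prime⇒irreducible prime[2] q∣2
... | inj₁ q≡1 = ℕ.nonTrivial⇒≢1 {{prime⇒nonTrivial qp}} q≡1
... | inj₂ q≡2 = q≢2 q≡2

*-distribˡ-minus : ∀ c a b → c * a - c * b ≡ c * (a - b)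
*-distribˡ-minus = solve-∀

*-distribʳ-minus : ∀ a b c → a * c - b * c ≡ (a - b) * c
*-distribʳ-minus = solve-∀

bézout-in-ℤ : ∀ a b c d → 1 ℕ.+ a ℕ.* b ≡ c ℕ.* d → + 1 + + a * + b ≡ + c * + d
bézout-in-ℤ a b c d e = begin
  + 1 + + a * + b   ≡⟨ cong (_+_ (+ 1)) (sym (ℤP.pos-* a b)) ⟩
  + (1 ℕ.+ a ℕ.* b) ≡⟨ cong +_ e ⟩
  + (c ℕ.* d)       ≡⟨ ℤP.pos-* c d ⟩
  + c * + d         ∎
  where open ≡-Reasoning

inverseMod : ∀ {u m} → Coprime u m → ∃ λ i → m ∣ℤ + u * i - + 1
inverseMod {u} {m} c with coprime-Bézout c
... | Bézout.+- i k eq = + i , divides (+ k) (begin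
      + u * + i - + 1       ≡⟨ cong (_- + 1) (ℤP.*-comm (+ u) (+ i)) ⟩
      + i * + u - + 1       ≡⟨ cong (_- + 1) (sym (bézout-in-ℤ k m i u eq)) ⟩
      + 1 + + k * + m - + 1 ≡⟨ cancel (+ k * + m) ⟩
      + k * + m             ∎)
  where
  open ≡-Reasoning
  cancel : ∀ z → + 1 + z - + 1 ≡ z
  cancel = solve-∀
... | Bézout.-+ i k eq = - + i , divides (- + k) (begin
      + u * - + i - + 1       ≡⟨ regroup (+ u) (+ i) ⟩
      - (+ 1 + + i * + u)     ≡⟨ cong -_ (bézout-in-ℤ i u k m eq) ⟩
      - (+ k * + m)           ≡⟨ ℤP.neg-distribˡ-* (+ k) (+ m) ⟩
      - + k * + m             ∎)
  where
  open ≡-Reasoning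
  regroup : ∀ u i → u * - i - + 1 ≡ - (+ 1 + i * u)
  regroup = solve-∀

cancelUnit : ∀ {u m z} → Coprime u m → m ∣ℤ + u * z → m ∣ℤ z
cancelUnit {u} {m} {z} c d =
  ∣ᵤ⇒∣ (ℤCoprimality.coprime-divisor (+ m) (+ u) z (Coprimality.sym c) (∣⇒∣ᵤ d))

cancel-affine : ∀ {k m} X R → Coprime k m → m ∣ℤ + k * X + R → m ∣ℤ R → m ∣ℤ X
cancel-affine X R c m∣kX+R m∣R = cancelUnit c (Signed.∣m+n∣n⇒∣m m∣kX+R m∣R)

module QAdic (q : ℕ) where

  record Coherent (s : ℕ → ℤ) : Set where
    constructor coherence
    field cong-step : ∀ n → Cong (q ^ n) (s (ℕ.suc n)) (s n)

  step : ∀ {s} → Coherent s → ∀ n → q ^ n ∣ℤ s (ℕ.suc n) - s n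
  step cs n = ∣ᵤ⇒∣ (Coherent.cong-step cs n)

  q^n∣q^1+n : ∀ n → q ^ n ∣ℤ + (q ^ ℕ.suc n)
  q^n∣q^1+n n = divides (+ q) (ℤP.pos-* q (q ^ n))

  q∣q^1+n : ∀ n → q ∣ℤ + (q ^ ℕ.suc n)
  q∣q^1+n n = divides (+ (q ^ n)) (trans (ℤP.pos-* q (q ^ n)) (ℤP.*-comm (+ q) (+ (q ^ n))))

  coherent-const : ∀ c → Coherent (λ _ → c)
  coherent-const c = coherence λ n → ∣⇒∣ᵤ (subst (q ^ n ∣ℤ_) (sym (ℤP.+-inverseʳ c)) (∣ℤ-zero _))

  coherent-+ : ∀ {s t} → Coherent s → Coherent t → Coherent (λ n → s n + t n)
  coherent-+ {s} {t} cs ct = coherence λ n → ∣⇒∣ᵤ (subst (q ^ n ∣ℤ_)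
      (sym (regroup (s (ℕ.suc n)) (s n) (t (ℕ.suc n)) (t n)))
      (Signed.∣m∣n⇒∣m+n (step cs n) (step ct n)))
    where
    regroup : ∀ a b c d → a + c - (b + d) ≡ (a - b) + (c - d)
    regroup = solve-∀

  coherent-* : ∀ c {s} → Coherent s → Coherent (λ n → c * s n)
  coherent-* c {s} cs = coherence λ n → ∣⇒∣ᵤ (subst (q ^ n ∣ℤ_)
      (sym (*-distribˡ-minus c (s (ℕ.suc n)) (s n)))
      (Signed.∣n⇒∣m*n c (step cs n)))

  coherent-neg : ∀ {s} → Coherent s → Coherent (λ n → - s n)
  coherent-neg {s} cs = coherence λ n → ∣⇒∣ᵤ (subst (q ^ n ∣ℤ_)
      (sym (regroup (s (ℕ.suc n)) (s n)))
      (Signed.∣m⇒∣-m (step cs n)))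
    where
    regroup : ∀ a b → - a - - b ≡ - (a - b)
    regroup = solve-∀

  -- Every q-adic integer lies in u·ℤ_q when u is a unit mod q: with u·iₙ ≡ 1 (mod qⁿ),
  -- the sequence iₙ·sₙ is coherent and u·iₙ·sₙ ≡ sₙ (mod qⁿ).
  unitIdeal : ∀ {u} s → Coprime u q → Coherent s → InIdeal q u s
  unitIdeal {u} s c cs = w , λ n → ∣⇒∣ᵤ (subst (q ^ n ∣ℤ_) (unit-error (+ u) (i n) (s n))
                                             (Signed.∣m⇒∣-m (Signed.∣m⇒∣m*n (s n) (inverse n))))
    where
    i : ℕ → ℤ
    i n = proj₁ (inverseMod (coprime-^ c n))
    inverse : ∀ n → q ^ n ∣ℤ + u * i n - + 1
    inverse n = proj₂ (inverseMod (coprime-^ c n))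
    unit-error : ∀ u i s → - ((u * i - + 1) * s) ≡ s - u * (i * s)
    unit-error = solve-∀
    expand : ∀ u i' i s' s → (u * i' - + 1) * s' - (u * i - + 1) * s + (s' - s)
                             ≡ u * (i' * s' - i * s)
    expand = solve-∀
    w-coherent : ∀ n → q ^ n ∣ℤ i (ℕ.suc n) * s (ℕ.suc n) - i n * s n
    w-coherent n = cancelUnit (coprime-^ c n)
      (subst (q ^ n ∣ℤ_) (expand (+ u) (i (ℕ.suc n)) (i n) (s (ℕ.suc n)) (s n))
        (Signed.∣m∣n⇒∣m+n
          (Signed.∣m∣n⇒∣m-n
            (Signed.∣m⇒∣m*n (s (ℕ.suc n)) (Signed.∣-trans (q^n∣q^1+n n) (inverse (ℕ.suc n))))
            (Signed.∣m⇒∣m*n (s n) (inverse n)))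
          (step cs n)))
    w : ℤ[ q ]
    w = record { approx = λ n → i n * s n ; coherent = λ n → ∣⇒∣ᵤ (w-coherent n) }

  ideal⇒level1 : ∀ {d} s → q ∣ℤ + d → InIdeal q d s → q ∣ℤ s 1
  ideal⇒level1 {d} s q∣d (w , s≡dw) =
    Signed.∣m+n∣n⇒∣m (Signed.∣-trans (q∣q^1+n 0) (∣ᵤ⇒∣ (s≡dw 1)))
                     (Signed.∣m⇒∣-m (Signed.∣m⇒∣m*n (approx w 1) q∣d))

  level1⇒divisible : ∀ s → Coherent s → q ∣ℤ s 1 → ∀ n → q ∣ℤ s (ℕ.suc n)
  level1⇒divisible s cs q∣s₁ ℕ.zero    = q∣s₁
  level1⇒divisible s cs q∣s₁ (ℕ.suc n) =
    Signed.∣m+n∣n⇒∣m (Signed.∣-trans (q∣q^1+n n) (step cs (ℕ.suc n)))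
                     (Signed.∣m⇒∣-m (level1⇒divisible s cs q∣s₁ n))

  quotient-coherent : .{{_ : ℕ.NonZero q}} → ∀ s r → Coherent s →
                      (∀ n → s (ℕ.suc n) ≡ r n * + q) → Coherent r
  -- (the step qⁿ⁺¹ ∣ sₙ₊₂ − sₙ₊₁ = (rₙ₊₁ − rₙ)·q, cancelled by q)
  quotient-coherent s r cs s≡rq = coherence λ n → ∣⇒∣ᵤ
    (Signed.*-cancelʳ-∣ (+ q) {+ (q ^ n)} {r (ℕ.suc n) - r n}
      (subst₂ Signed._∣_ (trans (ℤP.pos-* q (q ^ n)) (ℤP.*-comm (+ q) (+ (q ^ n))))
                         (trans (cong₂ _-_ (s≡rq (ℕ.suc n)) (s≡rq n))
                                (*-distribʳ-minus (r (ℕ.suc n)) (r n) (+ q)))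
                         (step cs (ℕ.suc n))))

  shiftIdeal : ∀ {u} s r → Coherent s → (∀ n → s (ℕ.suc n) ≡ r n * + q) →
               InIdeal q u r → InIdeal q (u ℕ.* q) s
  shiftIdeal {u} s r cs s≡rq (w , r≡uw) = w , λ n → ∣⇒∣ᵤ (subst (q ^ n ∣ℤ_) (regroup n)
      (Signed.∣m∣n⇒∣m+n (Signed.∣m⇒∣-m (step cs n)) (Signed.∣n⇒∣m*n (+ q) (∣ᵤ⇒∣ (r≡uw n)))))
    where
    rearrange : ∀ s r q u w → - (r * q - s) + q * (r - u * w) ≡ s - (u * q) * w
    rearrange = solve-∀
    regroup : ∀ n → - (s (ℕ.suc n) - s n) + + q * (r n - + u * approx w n)
                    ≡ s n - + (u ℕ.* q) * approx w n
    regroup n = begin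
      - (s (ℕ.suc n) - s n) + + q * (r n - + u * approx w n)
        ≡⟨ cong (λ t → - (t - s n) + + q * (r n - + u * approx w n)) (s≡rq n) ⟩
      - (r n * + q - s n) + + q * (r n - + u * approx w n)
        ≡⟨ rearrange (s n) (r n) (+ q) (+ u) (approx w n) ⟩
      s n - (+ u * + q) * approx w n
        ≡⟨ cong (λ t → s n - t * approx w n) (sym (ℤP.pos-* u q)) ⟩
      s n - + (u ℕ.* q) * approx w n
        ∎
      where open ≡-Reasoning

  -- A q-adic integer divisible by q at level 1 lies in uq·ℤ_q for every unit u:
  -- write sₙ₊₁ = rₙ·q and put r into u·ℤ_q.
  qIdeal : .{{_ : ℕ.NonZero q}} → ∀ {u} s → Coprime u q → Coherent s → q ∣ℤ s 1 →
           InIdeal q (u ℕ.* q) s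
  qIdeal {u} s c cs q∣s₁ =
    shiftIdeal {u} s r cs s≡rq (unitIdeal r c (quotient-coherent s r cs s≡rq))
    where
    r : ℕ → ℤ
    r n = Signed.quotient (level1⇒divisible s cs q∣s₁ n)
    s≡rq : ∀ n → s (ℕ.suc n) ≡ r n * + q
    s≡rq n = Signed._∣_.equality (level1⇒divisible s cs q∣s₁ n)

isZBasis-resp : ∀ {S T : Coords → Set} f → (∀ v → S v → T v) → (∀ v → T v → S v) →
                IsZBasisOf S f → IsZBasisOf T f
isZBasis-resp f S⇒T T⇒S (inS , span , indep) =
  (λ i → S⇒T _ (inS i)) , (λ v Tv → span v (T⇒S v Tv)) , indep

module Lattice (q : ℕ) .{{_ : ℕ.NonZero q}} (α β : ℤ) where

  form : Coords → ℤ
  form v = v i₁ - α * v i₂ - β * v i₃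

  Λ : Coords → Set
  Λ v = q ∣ℤ form v

  basis : Fin 4 → Coords
  basis = four ⟨ + 1 , + 0 , + 0 , + 0 ⟩ ⟨ + 0 , α , + 1 , + 0 ⟩
               ⟨ + 0 , β , + 0 , + 1 ⟩ ⟨ + 0 , + q , + 0 , + 0 ⟩

  combination : (Fin 4 → ℤ) → Coords
  combination c = ⟨ c i₀ , c i₁ * α + c i₂ * β + c i₃ * + q
                  , c i₁ , c i₂ ⟩

  lincomb-basis : ∀ c k → lincomb c basis k ≡ combination c k
  lincomb-basis c i₀ = pick₀ (c i₀) (c i₁) (c i₂) (c i₃)
    where
    pick₀ : ∀ a b c d → a * + 1 + b * + 0 + c * + 0 + d * + 0 ≡ a
    pick₀ = solve-∀
  lincomb-basis c i₁ =
    pick₁ (c i₀) (c i₁) (c i₂) (c i₃) α β (+ q)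
    where
    pick₁ : ∀ a b c d α β q → a * + 0 + b * α + c * β + d * q ≡ b * α + c * β + d * q
    pick₁ = solve-∀
  lincomb-basis c i₂ =
    pick₂ (c i₀) (c i₁) (c i₂) (c i₃)
    where
    pick₂ : ∀ a b c d → a * + 0 + b * + 1 + c * + 0 + d * + 0 ≡ b
    pick₂ = solve-∀
  lincomb-basis c i₃ =
    pick₃ (c i₀) (c i₁) (c i₂) (c i₃)
    where
    pick₃ : ∀ a b c d → a * + 0 + b * + 0 + c * + 1 + d * + 0 ≡ c
    pick₃ = solve-∀

  basis∈Λ : ∀ i → Λ (basis i)
  basis∈Λ i₀ = subst (q ∣ℤ_) (sym (vanish α β)) (∣ℤ-zero q)
    where
    vanish : ∀ α β → + 0 - α * + 0 - β * + 0 ≡ + 0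
    vanish = solve-∀
  basis∈Λ i₁ = subst (q ∣ℤ_) (sym (vanish α β)) (∣ℤ-zero q)
    where
    vanish : ∀ α β → α - α * + 1 - β * + 0 ≡ + 0
    vanish = solve-∀
  basis∈Λ i₂ = subst (q ∣ℤ_) (sym (vanish α β)) (∣ℤ-zero q)
    where
    vanish : ∀ α β → β - α * + 0 - β * + 1 ≡ + 0
    vanish = solve-∀
  basis∈Λ i₃ = divides (+ 1) (reduce α β (+ q))
    where
    reduce : ∀ α β t → t - α * + 0 - β * + 0 ≡ + 1 * t
    reduce = solve-∀

  Λ-spanned : ∀ v → Λ v → ∃ λ c → ∀ k → lincomb c basis k ≡ v k
  Λ-spanned v (divides K form≡Kq) = ⟨ v i₀ , v₂ , v₃ , K ⟩ , λ k →
    trans (lincomb-basis ⟨ v i₀ , v₂ , v₃ , K ⟩ k) (coordinates k)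
    where
    v₁ v₂ v₃ : ℤ
    v₁ = v i₁
    v₂ = v i₂
    v₃ = v i₃
    solve-v₁ : ∀ v₁ v₂ v₃ α β → v₂ * α + v₃ * β + (v₁ - α * v₂ - β * v₃) ≡ v₁
    solve-v₁ = solve-∀
    coordinates : ∀ k → combination ⟨ v i₀ , v₂ , v₃ , K ⟩ k ≡ v k
    coordinates i₀ = refl
    coordinates i₁ =
      trans (cong (_+_ (v₂ * α + v₃ * β)) (sym form≡Kq)) (solve-v₁ v₁ v₂ v₃ α β)
    coordinates i₂ = refl
    coordinates i₃ = refl

  -- Coefficients are read off coordinates 0, 2, 3, and then (as q ≠ 0) coordinate 1.
  basis-independent : ∀ c c' → (∀ k → lincomb c basis k ≡ lincomb c' basis k) → ∀ i → c i ≡ c' i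
  basis-independent c c' E = coefficient
    where
    same : ∀ k → combination c k ≡ combination c' k
    same k = trans (sym (lincomb-basis c k)) (trans (E k) (lincomb-basis c' k))
    isolate : ∀ a b d α β q → d * q ≡ a * α + b * β + d * q - (a * α + b * β)
    isolate = solve-∀
    coefficient : ∀ i → c i ≡ c' i
    coefficient i₀ = same i₀
    coefficient i₁ = same i₂
    coefficient i₂ = same i₃
    coefficient i₃ = ℤP.*-cancelʳ-≡ _ _ (+ q) (begin
      c i₃ * + q
        ≡⟨ isolate (c i₁) (c i₂) (c i₃) α β (+ q) ⟩
      combination c i₁ - (c i₁ * α + c i₂ * β)
        ≡⟨ cong₂ (λ t u → t - u) (same i₁)
             (cong₂ (λ a b → a * α + b * β) (coefficient i₁) (coefficient i₂)) ⟩
      combination c' i₁ - (c' i₁ * α + c' i₂ * β)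
        ≡⟨ sym (isolate (c' i₁) (c' i₂) (c' i₃) α β (+ q)) ⟩
      c' i₃ * + q
        ∎)
      where open ≡-Reasoning

  Λ-basis : IsZBasisOf Λ basis
  Λ-basis = basis∈Λ , Λ-spanned , basis-independent

module EichlerLattices (Δ N p : ℕ) (a : ℤ) (q : ℕ) .{{_ : ℕ.NonZero q}} (x y : ℤ[ q ])
  (c₁ c₂ c₃ : ℤ) (2⊥q : Coprime 2 q) (p⊥q : Coprime p q) (N⊥q : Coprime N q)
  (c₁≡y−x : q ∣ℤ c₁ - (approx y 1 - approx x 1)) (c₂p≡1 : q ∣ℤ c₂ * + p - + 1)
  (c₃≡x : q ∣ℤ c₃ - approx x 1) where

  open Setup Δ N p a q x y
  open QAdic q

  x-coherent : Coherent (approx x)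
  x-coherent = coherence (coherent x)

  y-coherent : Coherent (approx y)
  y-coherent = coherence (coherent y)

  Φ11-coherent : ∀ v → Coherent (Φ11 v)
  Φ11-coherent v = coherent-+ (coherent-+ (coherent-const (T0 v)) (coherent-* (T1 v) x-coherent))
                              (coherent-* (T3 v) (coherent-neg (coherent-* P y-coherent)))

  Φ12-coherent : ∀ v → Coherent (Φ12 v)
  Φ12-coherent v = coherent-+ (coherent-+ (coherent-* (T1 v) (coherent-neg (coherent-* P y-coherent)))
                                          (coherent-const (T2 v * P)))
                              (coherent-* (T3 v) (coherent-* P x-coherent))

  Φ21-coherent : ∀ v → Coherent (Φ21 v)
  Φ21-coherent v = coherent-+ (coherent-+ (coherent-* (T1 v) y-coherent) (coherent-const (T2 v)))
                              (coherent-* (T3 v) (coherent-neg x-coherent))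

  Φ22-coherent : ∀ v → Coherent (Φ22 v)
  Φ22-coherent v = coherent-+ (coherent-+ (coherent-const (T0 v)) (coherent-* (T1 v) (coherent-neg x-coherent)))
                              (coherent-* (T3 v) (coherent-* P y-coherent))

  2p⊥q : Coprime (2 ℕ.* p) q
  2p⊥q = coprime-*ˡ 2⊥q p⊥q

  2pN⊥q : Coprime (2 ℕ.* p ℕ.* N) q
  2pN⊥q = coprime-*ˡ 2p⊥q N⊥q

  x₁ y₁ : ℤ
  x₁ = approx x 1
  y₁ = approx y 1

  module L  = Lattice q (- c₁) (- (+ 2 * c₂ * (a * ΔN - c₃)))
  module L' = Lattice q c₁ (- (+ 2 * c₂ * (a * ΔN + c₃)))

  -- Level-1 values of the two decisive entries: up to multiples of the congruences
  -- c₁ ≡ y − x, c₃ ≡ x, c₂ p ≡ 1, they are p·form and p²·form for the defining forms of L, L'.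
  error-L error-L' : Coords → ℤ
  error-L v = - (P * v i₂) * (c₁ - (y₁ - x₁))
            + + 2 * v i₃ * (c₃ - x₁)
            - + 2 * v i₃ * (a * ΔN - c₃) * (c₂ * P - + 1)
  error-L' v = P * v i₂ * (c₁ - (y₁ - x₁))
             - + 2 * v i₃ * (c₃ - x₁)
             - + 2 * v i₃ * (a * ΔN + c₃) * (c₂ * P - + 1)

  error-L-divisible : ∀ v → q ∣ℤ error-L v
  error-L-divisible v =
    Signed.∣m∣n⇒∣m-n (Signed.∣m∣n⇒∣m+n (Signed.∣n⇒∣m*n (- (P * v₂)) c₁≡y−x)
                                       (Signed.∣n⇒∣m*n (+ 2 * v₃) c₃≡x))
                     (Signed.∣n⇒∣m*n (+ 2 * v₃ * (a * ΔN - c₃)) c₂p≡1)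
    where
    v₂ v₃ : ℤ
    v₂ = v i₂
    v₃ = v i₃

  error-L'-divisible : ∀ v → q ∣ℤ error-L' v
  error-L'-divisible v =
    Signed.∣m∣n⇒∣m-n (Signed.∣m∣n⇒∣m-n (Signed.∣n⇒∣m*n (P * v₂) c₁≡y−x)
                                       (Signed.∣n⇒∣m*n (+ 2 * v₃) c₃≡x))
                     (Signed.∣n⇒∣m*n (+ 2 * v₃ * (a * ΔN + c₃)) c₂p≡1)
    where
    v₂ v₃ : ℤ
    v₂ = v i₂
    v₃ = v i₃

  Φ21-level1 : ∀ v → Φ21 v 1 ≡ P * L.form v + error-L v
  Φ21-level1 v = identity P (v i₁) (v i₂) (v i₃)
                          a ΔN x₁ y₁ c₁ c₂ c₃
    where
    identity : ∀ P v₁ v₂ v₃ a dn x y c₁ c₂ c₃ →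
      P * v₂ * y + (P * v₁ + + 2 * a * dn * v₃) + (P * v₂ + + 2 * v₃) * (- x)
      ≡ P * (v₁ - (- c₁) * v₂ - (- (+ 2 * c₂ * (a * dn - c₃))) * v₃)
        + (- (P * v₂) * (c₁ - (y - x)) + + 2 * v₃ * (c₃ - x)
           - + 2 * v₃ * (a * dn - c₃) * (c₂ * P - + 1))
    identity = solve-∀

  Φ12-level1 : ∀ v → Φ12 v 1 ≡ P * (P * L'.form v + error-L' v)
  Φ12-level1 v = identity P (v i₁) (v i₂) (v i₃)
                          a ΔN x₁ y₁ c₁ c₂ c₃
    where
    identity : ∀ P v₁ v₂ v₃ a dn x y c₁ c₂ c₃ →
      P * v₂ * (- (P * y)) + (P * v₁ + + 2 * a * dn * v₃) * P + (P * v₂ + + 2 * v₃) * (P * x)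
      ≡ P * (P * (v₁ - c₁ * v₂ - (- (+ 2 * c₂ * (a * dn + c₃))) * v₃)
             + (P * v₂ * (c₁ - (y - x)) - + 2 * v₃ * (c₃ - x)
                - + 2 * v₃ * (a * dn + c₃) * (c₂ * P - + 1)))
    identity = solve-∀

  -- h ∈ L  ⇔  q ∣ form_L(h): the (2,1) entry is the only condition, the others hold
  -- automatically since 2p and 2pN are units mod q.
  2pN·q≡2p·qN : 2 ℕ.* p ℕ.* N ℕ.* q ≡ 2 ℕ.* p ℕ.* (q ℕ.* N)
  2pN·q≡2p·qN = regroup p N q
    where
    regroup : ∀ p N q → 2 ℕ.* p ℕ.* N ℕ.* q ≡ 2 ℕ.* p ℕ.* (q ℕ.* N)
    regroup = ℕSolver.solve-∀

  q∣2p·qN : q ∣ℤ + (2 ℕ.* p ℕ.* (q ℕ.* N))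
  q∣2p·qN = subst (λ d → q ∣ℤ + d) 2pN·q≡2p·qN (∣ℤ-*ˡ (2 ℕ.* p ℕ.* N) q)

  InL⇒Λ : ∀ v → InL v → L.Λ v
  InL⇒Λ v (_ , _ , Φ21∈ , _) =
    cancel-affine (L.form v) (error-L v) p⊥q
      (subst (q ∣ℤ_) (Φ21-level1 v) (ideal⇒level1 (Φ21 v) q∣2p·qN Φ21∈))
      (error-L-divisible v)

  Λ⇒InL : ∀ v → L.Λ v → InL v
  Λ⇒InL v q∣form =
    unitIdeal (Φ11 v) 2p⊥q (Φ11-coherent v) ,
    unitIdeal (Φ12 v) 2p⊥q (Φ12-coherent v) ,
    subst (λ d → InIdeal q d (Φ21 v)) 2pN·q≡2p·qN
          (qIdeal (Φ21 v) 2pN⊥q (Φ21-coherent v) q∣Φ21₁) ,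
    unitIdeal (Φ22 v) 2p⊥q (Φ22-coherent v)
    where
    q∣Φ21₁ : q ∣ℤ Φ21 v 1
    q∣Φ21₁ = subst (q ∣ℤ_) (sym (Φ21-level1 v))
               (Signed.∣m∣n⇒∣m+n (Signed.∣n⇒∣m*n P q∣form) (error-L-divisible v))

  -- h ∈ L'  ⇔  q ∣ form_L'(h): now the (1,2) entry is the only condition.
  InL'⇒Λ : ∀ v → InL' v → L'.Λ v
  InL'⇒Λ v (_ , Φ12∈ , _ , _) =
    cancel-affine (L'.form v) (error-L' v) p⊥q
      (cancelUnit p⊥q (subst (q ∣ℤ_) (Φ12-level1 v)
        (ideal⇒level1 (Φ12 v) (∣ℤ-*ˡ (2 ℕ.* p) q) Φ12∈)))
      (error-L'-divisible v)

  Λ⇒InL' : ∀ v → L'.Λ v → InL' v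
  Λ⇒InL' v q∣form =
    unitIdeal (Φ11 v) 2p⊥q (Φ11-coherent v) ,
    qIdeal (Φ12 v) 2p⊥q (Φ12-coherent v) q∣Φ12₁ ,
    unitIdeal (Φ21 v) 2pN⊥q (Φ21-coherent v) ,
    unitIdeal (Φ22 v) 2p⊥q (Φ22-coherent v)
    where
    q∣Φ12₁ : q ∣ℤ Φ12 v 1
    q∣Φ12₁ = subst (q ∣ℤ_) (sym (Φ12-level1 v)) (Signed.∣n⇒∣m*n P
               (Signed.∣m∣n⇒∣m+n (Signed.∣n⇒∣m*n P q∣form) (error-L'-divisible v)))

  L-basis : IsZBasisOf InL L.basis
  L-basis = isZBasis-resp L.basis Λ⇒InL InL⇒Λ L.Λ-basis

  L'-basis : IsZBasisOf InL' L'.basis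
  L'-basis = isZBasis-resp L'.basis Λ⇒InL' InL'⇒Λ L'.Λ-basis

mainTheorem1 :
  (Δ N p : ℕ) → EvenDistinctPrimeProduct Δ →
  0 < N → Coprime N Δ →
  Prime p → p % 4 ≡ 1 → (2 ∣ Δ → p % 8 ≡ 5) → (2 ∣ N → p % 8 ≡ 1) →
  (∀ ℓ → OddPrime ℓ → ℓ ∣ Δ → LegendreIsMinusOne p ℓ) →
  (∀ ℓ → OddPrime ℓ → ℓ ∣ N → LegendreIsOne p ℓ) →
  (a : ℤ) → Cong p (a * a * + (Δ ℕ.* N) + + 1) (+ 0) →
  (q : ℕ) → Prime q → ¬ (q ∣ Δ ℕ.* p) → LegendreIsMinusOne p q →
  (x y : ℤ[ q ]) →
  (∀ n → Cong (q ^ n) (- + (Δ ℕ.* N))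
                      (approx x n * approx x n - + p * (approx y n * approx y n))) →
  (c₁ c₂ c₃ : ℤ) →
  InIdeal q q (λ n → c₁ - (approx y n - approx x n)) →
  Cong q (c₂ * + p) (+ 1) →
  InIdeal q q (λ n → c₃ - approx x n) →
  IsZBasisOf (Setup.InL Δ N p a q x y)
    (four ⟨ + 1 , + 0 , + 0 , + 0 ⟩
          ⟨ + 0 , - c₁ , + 1 , + 0 ⟩
          ⟨ + 0 , - (+ 2 * c₂ * (a * + (Δ ℕ.* N) - c₃)) , + 0 , + 1 ⟩
          ⟨ + 0 , + q , + 0 , + 0 ⟩)
  ×
  IsZBasisOf (Setup.InL' Δ N p a q x y)
    (four ⟨ + 1 , + 0 , + 0 , + 0 ⟩
          ⟨ + 0 , c₁ , + 1 , + 0 ⟩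
          ⟨ + 0 , - (+ 2 * c₂ * (a * + (Δ ℕ.* N) + c₃)) , + 0 , + 1 ⟩
          ⟨ + 0 , + q , + 0 , + 0 ⟩)
mainTheorem1 Δ N p _ _ _ _ _ _ _ _ N-residues a _ q q-prime _ (q-odd , q∤p , p-nonresidue)
             x y _ c₁ c₂ c₃ c₁≡y−x c₂p≡1 c₃≡x = L-basis , L'-basis
  where
  -- q ∤ N, since (p/ℓ) = 1 for odd primes ℓ ∣ N but (p/q) = −1.
  q∤N : ¬ q ∣ N
  q∤N q∣N = p-nonresidue (proj₂ (proj₂ (N-residues q q-odd q∣N)))
  level1 : ∀ s → InIdeal q q s → q ∣ℤ s 1
  level1 s = QAdic.ideal⇒level1 q s Signed.∣-refl
  open EichlerLattices Δ N p a q {{prime⇒nonZero q-prime}} x y c₁ c₂ c₃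
         (prime⇒coprime q-prime (oddPrime∤2 q-odd)) (prime⇒coprime q-prime q∤p)
         (prime⇒coprime q-prime q∤N)
         (level1 (λ n → c₁ - (approx y n - approx x n)) c₁≡y−x) (∣ᵤ⇒∣ c₂p≡1)
         (level1 (λ n → c₃ - approx x n) c₃≡x)
    using (L-basis; L'-basis)
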